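{- Let $q$ be a power of a prime $p$. For a prime power $Q$, let $\overline{\rho}_Q=\lim_{x\to+\infty}\frac1x\sum_{n\le x}\rho_Q(n)$, where $\rho_Q(n)=\frac{\varphi(Q^n-1)}{Q^n}$ is the density of primitive elements in $\mathbb{F}_{Q^n}$ (this limit exists). Then $\liminf_{i\to+\infty}\overline{\rho}_{q^i}=0$.
   Context: $\varphi$ is Euler's totient function; a primitive element of $\mathbb{F}_{Q^n}$ is a generator of the cyclic group $\mathbb{F}_{Q^n}^*$. -}

module Defs where

open import Data.Nat using (ℕ; zero; suc; _^_; _∸_; _≤_)
open import Data.Nat.Coprimality using (Coprime; coprime?)
open import Data.Nat.Primality using (Prime)
open import Data.Integer using (+_)
open import Data.Rational using (ℚ; 0ℚ; _/_; _+_; _*_)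
open import Data.List using (List; filter; length; map; upTo)
open import Data.Product using (∃; _×_)
open import Relation.Binary.PropositionalEquality using (_≡_)

-- Euler's totient: φ m = #{ k ∈ {1,…,m} ∣ gcd(k,m) = 1 }  (so φ 1 = 1, φ 0 = 0).
φ : ℕ → ℕ
φ m = length (filter (λ k → coprime? k m) (map suc (upTo m)))

IsPrimePower : ℕ → Set
IsPrimePower q = ∃ λ p → ∃ λ k → Prime p × 1 ≤ k × q ≡ p ^ k

-- a / b as a rational number (b = 0 gives 0; never used with b = 0 below).
frac : ℕ → ℕ → ℚ
frac a zero    = 0ℚ
frac a (suc b) = (+ a) / suc b

ρ : ℕ → ℕ → ℚ
ρ Q n = frac (φ (Q ^ n ∸ 1)) (Q ^ n)

ρsum : ℕ → ℕ → ℚ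
ρsum Q zero    = 0ℚ
ρsum Q (suc x) = ρsum Q x + ρ Q (suc x)

-- (1/x) Σ_{n ≤ x} ρ_Q(n)   (value 0 at x = 0)
ρavg : ℕ → ℕ → ℚ
ρavg Q x = frac 1 x * ρsum Q x

module Submission where

-- Given ε > 0 pick B with 1/B < ε.  The heart of the proof is an elementary fact: a number M
-- with many small divisors has small totient.  If k₁ < ⋯ < k_T (T = 2^J) divide M and k_t ≤ c t,
-- then φ(M) ≤ k_t φ(M/k_t) ≤ c t φ(M/k_t), while Σ_t φ(M/k_t) ≤ M because the classes
-- {x ≤ M : gcd(x, M) = k_t} are disjoint and have at least φ(M/k_t) elements; summing over
-- dyadic blocks of t gives J φ(M) ≤ 2 c M.  We apply it with k_t = q t + 1 (t ≤ 2^(2(q+1)B)):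
-- these are coprime to q and at most P = q 2^(2(q+1)B) + 1, so the order of q modulo k_t divides
-- P!, and for i = (N + 1) P! every k_t divides M = (q^i)^n − 1, whence B φ(M) ≤ M and
-- ρ_{q^i}(n) ≤ 1/B for all n.  The averages ρavg (q^i) x are then all ≤ 1/B < ε.

open import Defs
open import Data.Nat using (ℕ; suc; _^_; _≤_)
open import Data.Product using (∃; _×_; _,_)

module FiniteSums where

  open import Data.Nat
  open import Data.Nat.Properties
  open import Algebra.Properties.CommutativeSemigroup +-commutativeSemigroup using (interchange)
  open import Relation.Binary.PropositionalEquality

  ∑ : ℕ → (ℕ → ℕ) → ℕ
  ∑ zero    f = 0
  ∑ (suc n) f = ∑ n f + f (suc n)

  ∑-cong : ∀ n {f g : ℕ → ℕ} → (∀ x → f x ≡ g x) → ∑ n f ≡ ∑ n g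
  ∑-cong zero    f≡g = refl
  ∑-cong (suc n) f≡g = cong₂ _+_ (∑-cong n f≡g) (f≡g (suc n))

  ∑-mono : ∀ n {f g : ℕ → ℕ} → (∀ x → 1 ≤ x → x ≤ n → f x ≤ g x) → ∑ n f ≤ ∑ n g
  ∑-mono zero    f≤g = z≤n
  ∑-mono (suc n) f≤g =
    +-mono-≤ (∑-mono n (λ x 1≤x x≤n → f≤g x 1≤x (m≤n⇒m≤1+n x≤n))) (f≤g (suc n) (s≤s z≤n) ≤-refl)

  ∑-+ : ∀ n (f g : ℕ → ℕ) → ∑ n (λ x → f x + g x) ≡ ∑ n f + ∑ n g
  ∑-+ zero    f g = refl
  ∑-+ (suc n) f g = trans (cong (_+ (f (suc n) + g (suc n))) (∑-+ n f g))
                          (interchange (∑ n f) (∑ n g) (f (suc n)) (g (suc n)))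

  ∑-scale : ∀ n c (f : ℕ → ℕ) → ∑ n (λ x → c * f x) ≡ c * ∑ n f
  ∑-scale zero    c f = sym (*-zeroʳ c)
  ∑-scale (suc n) c f = trans (cong (_+ c * f (suc n)) (∑-scale n c f))
                              (sym (*-distribˡ-+ c (∑ n f) (f (suc n))))

  ∑-const : ∀ n c → ∑ n (λ _ → c) ≡ n * c
  ∑-const zero    c = refl
  ∑-const (suc n) c = trans (cong (_+ c) (∑-const n c)) (+-comm (n * c) c)

  ∑-split : ∀ a b (f : ℕ → ℕ) → ∑ (a + b) f ≡ ∑ a f + ∑ b (λ x → f (a + x))
  ∑-split a zero    f = trans (cong (λ m → ∑ m f) (+-identityʳ a)) (sym (+-identityʳ (∑ a f)))
  ∑-split a (suc b) f = begin
      ∑ (a + suc b) f                                  ≡⟨ cong (λ m → ∑ m f) (+-suc a b) ⟩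
      ∑ (a + b) f + f (suc (a + b))                    ≡⟨ cong₂ _+_ (∑-split a b f) (cong f (sym (+-suc a b))) ⟩
      (∑ a f + ∑ b (λ x → f (a + x))) + f (a + suc b)  ≡⟨ +-assoc (∑ a f) _ _ ⟩
      ∑ a f + ∑ (suc b) (λ x → f (a + x))              ∎
    where open ≡-Reasoning

  ∑-periodic : ∀ j e (f : ℕ → ℕ) → (∀ x → f (e + x) ≡ f x) → ∑ (j * e) f ≡ j * ∑ e f
  ∑-periodic zero    e f periodic = refl
  ∑-periodic (suc j) e f periodic = begin
      ∑ (e + j * e) f                      ≡⟨ ∑-split e (j * e) f ⟩
      ∑ e f + ∑ (j * e) (λ x → f (e + x))  ≡⟨ cong (∑ e f +_) (∑-cong (j * e) periodic) ⟩
      ∑ e f + ∑ (j * e) f                  ≡⟨ cong (∑ e f +_) (∑-periodic j e f periodic) ⟩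
      ∑ e f + j * ∑ e f                    ∎
    where open ≡-Reasoning

  ∑-swap : ∀ n m (h : ℕ → ℕ → ℕ) → ∑ n (λ t → ∑ m (h t)) ≡ ∑ m (λ x → ∑ n (λ t → h t x))
  ∑-swap zero    m h = sym (trans (∑-const m 0) (*-zeroʳ m))
  ∑-swap (suc n) m h = begin
      ∑ n (λ t → ∑ m (h t)) + ∑ m (h (suc n))            ≡⟨ cong (_+ ∑ m (h (suc n))) (∑-swap n m h) ⟩
      ∑ m (λ x → ∑ n (λ t → h t x)) + ∑ m (h (suc n))    ≡⟨ sym (∑-+ m (λ x → ∑ n (λ t → h t x)) (h (suc n))) ⟩
      ∑ m (λ x → ∑ (suc n) (λ t → h t x))                ∎
    where open ≡-Reasoning

  ∑-zero : ∀ n (f : ℕ → ℕ) → (∀ x → 1 ≤ x → x ≤ n → f x ≡ 0) → ∑ n f ≡ 0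
  ∑-zero n f f≡0 = ≤-antisym (≤-trans (∑-mono n (λ x a b → ≤-reflexive (f≡0 x a b)))
                                      (≤-reflexive (trans (∑-const n 0) (*-zeroʳ n)))) z≤n

  ∑-last : ∀ n (f : ℕ → ℕ) → f (suc n) ≤ ∑ (suc n) f
  ∑-last n f = m≤n+m (f (suc n)) (∑ n f)

module Totient where

  open FiniteSums
  open import Data.Nat
  open import Data.Nat.Properties
  open import Data.Nat.Divisibility
  open import Data.Nat.GCD using (gcd; c*gcd[m,n]≡gcd[cm,cn])
  open import Data.Nat.Coprimality using (Coprime; coprime?; coprime⇒gcd≡1)
  open import Data.List using (_++_; [_]; filter; length; map; upTo)
  open import Data.List.Properties using (upTo-∷ʳ; map-++; filter-++; length-++)
  open import Relation.Nullary using (Dec; yes; no; ¬_)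
  open import Relation.Nullary.Negation using (contradiction)
  open import Relation.Unary using (Decidable)
  open import Relation.Binary.Definitions using (Monotonic₁)
  open import Relation.Binary.PropositionalEquality hiding ([_])

  𝟙 : {A : Set} → Dec A → ℕ
  𝟙 (yes _) = 1
  𝟙 (no _)  = 0

  𝟙-mono : {A B : Set} → (A → B) → (a : Dec A) (b : Dec B) → 𝟙 a ≤ 𝟙 b
  𝟙-mono A→B (yes a) (yes _) = ≤-refl
  𝟙-mono A→B (yes a) (no ¬b) = contradiction (A→B a) ¬b
  𝟙-mono A→B (no _)  b       = z≤n

  𝟙-cong : {A B : Set} → (A → B) → (B → A) → (a : Dec A) (b : Dec B) → 𝟙 a ≡ 𝟙 b
  𝟙-cong A→B B→A a b = ≤-antisym (𝟙-mono A→B a b) (𝟙-mono B→A b a)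

  𝟙-no : {A : Set} → ¬ A → (a : Dec A) → 𝟙 a ≡ 0
  𝟙-no ¬A a = n≤0⇒n≡0 (𝟙-mono ¬A a (no (λ ())))

  count≡∑ : ∀ {P : ℕ → Set} (P? : Decidable P) m →
            length (filter P? (map suc (upTo m))) ≡ ∑ m (λ x → 𝟙 (P? x))
  count≡∑ P? zero    = refl
  count≡∑ {P} P? (suc m) = begin
      length (filter P? (map suc (upTo (suc m))))
        ≡⟨ cong (λ xs → length (filter P? (map suc xs))) (sym (upTo-∷ʳ m)) ⟩
      length (filter P? (map suc (upTo m ++ [ m ])))
        ≡⟨ cong (λ xs → length (filter P? xs)) (map-++ suc (upTo m) [ m ]) ⟩
      length (filter P? (map suc (upTo m) ++ [ suc m ]))
        ≡⟨ cong length (filter-++ P? (map suc (upTo m)) [ suc m ]) ⟩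
      length (filter P? (map suc (upTo m)) ++ filter P? [ suc m ])
        ≡⟨ length-++ (filter P? (map suc (upTo m))) ⟩
      length (filter P? (map suc (upTo m))) + length (filter P? [ suc m ])
        ≡⟨ cong₂ _+_ (count≡∑ P? m) singleton ⟩
      ∑ (suc m) (λ x → 𝟙 (P? x)) ∎
    where
    open ≡-Reasoning
    singleton : length (filter P? [ suc m ]) ≡ 𝟙 (P? (suc m))
    singleton with P? (suc m)
    ... | yes _ = refl
    ... | no _  = refl

  coprimeTo : ℕ → ℕ → ℕ
  coprimeTo m x = 𝟙 (coprime? x m)

  φ≡∑ : ∀ m → φ m ≡ ∑ m (coprimeTo m)
  φ≡∑ m = count≡∑ (λ x → coprime? x m) m

  coprimeTo-periodic : ∀ e x → coprimeTo e (e + x) ≡ coprimeTo e x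
  coprimeTo-periodic e x = 𝟙-cong
    (λ cop {d} (d∣x , d∣e) → cop (∣m∣n⇒∣m+n d∣e d∣x , d∣e))
    (λ cop {d} (d∣e+x , d∣e) → cop (∣m+n∣m⇒∣n d∣e+x d∣e , d∣e))
    (coprime? (e + x) e) (coprime? x e)

  coprimeTo-multiple : ∀ k e x → coprimeTo (k * e) x ≤ coprimeTo e x
  coprimeTo-multiple k e x =
    𝟙-mono (λ cop {d} (d∣x , d∣e) → cop (d∣x , ∣-trans d∣e (n∣m*n k))) (coprime? x (k * e)) (coprime? x e)

  -- φ(k e) ≤ k φ(e): the range 1 … k e consists of k periods modulo e, and
  -- whatever is coprime to k e is coprime to e.
  φ-multiple : ∀ k e → φ (k * e) ≤ k * φ e
  φ-multiple k e = begin
      φ (k * e)                     ≡⟨ φ≡∑ (k * e) ⟩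
      ∑ (k * e) (coprimeTo (k * e)) ≤⟨ ∑-mono (k * e) (λ x _ _ → coprimeTo-multiple k e x) ⟩
      ∑ (k * e) (coprimeTo e)       ≡⟨ ∑-periodic k e (coprimeTo e) (coprimeTo-periodic e) ⟩
      k * ∑ e (coprimeTo e)         ≡⟨ cong (k *_) (φ≡∑ e) ⟨
      k * φ e                       ∎
    where open ≤-Reasoning

  gcdIs : ℕ → ℕ → ℕ → ℕ
  gcdIs M k x = 𝟙 (gcd x M ≟ k)

  -- y ↦ k y sends the y coprime to e to x with gcd(x, k e) = k …
  gcdIs-scaled : ∀ k e y → coprimeTo e y ≤ gcdIs (k * e) k (k * y)
  gcdIs-scaled k e y = 𝟙-mono {A = Coprime y e}
    (λ cop → begin
        gcd (k * y) (k * e) ≡⟨ c*gcd[m,n]≡gcd[cm,cn] k y e ⟨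
        k * gcd y e         ≡⟨ cong (k *_) (coprime⇒gcd≡1 cop) ⟩
        k * 1               ≡⟨ *-identityʳ k ⟩
        k                   ∎)
    (coprime? y e) (gcd (k * y) (k * e) ≟ k)
    where open ≡-Reasoning

  -- … so, for k ≥ 1, φ(e) ≤ #{x ≤ k e : gcd(x, k e) = k}.  Induction on the length j
  -- of the range: y = j + 1 lands in the last block k j + 1 … k j + k.
  φ≤gcdClass : ∀ k' e → φ e ≤ ∑ (suc k' * e) (gcdIs (suc k' * e) (suc k'))
  φ≤gcdClass k' e = ≤-trans (≤-reflexive (φ≡∑ e)) (prefix e)
    where
    k = suc k'
    g = gcdIs (k * e) k
    prefix : ∀ j → ∑ j (coprimeTo e) ≤ ∑ (k * j) g
    prefix zero    = z≤n
    prefix (suc j) = begin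
        ∑ j (coprimeTo e) + coprimeTo e (suc j)   ≤⟨ +-mono-≤ (prefix j) (gcdIs-scaled k e (suc j)) ⟩
        ∑ (k * j) g + g (k * suc j)               ≡⟨ cong (λ x → ∑ (k * j) g + g x) lastBlock ⟩
        ∑ (k * j) g + g (k * j + k)               ≤⟨ +-monoʳ-≤ (∑ (k * j) g) (∑-last k' (λ x → g (k * j + x))) ⟩
        ∑ (k * j) g + ∑ k (λ x → g (k * j + x))   ≡⟨ ∑-split (k * j) k g ⟨
        ∑ (k * j + k) g                           ≡⟨ cong (λ n → ∑ n g) lastBlock ⟨
        ∑ (k * suc j) g                           ∎
      where
      open ≤-Reasoning
      lastBlock : k * suc j ≡ k * j + k
      lastBlock = trans (*-suc k j) (+-comm k (k * j))

  -- For k₁ < k₂ < ⋯ < k_T dividing M with cofactors e_t (k_t e_t = M), Σ_t φ(e_t) ≤ M: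
  -- every x ≤ M lies in at most one class gcd(x, M) = k_t, and the t-th class has ≥ φ(e_t) elements.
  ∑φ-cofactors≤ : ∀ T M (k e : ℕ → ℕ) → Monotonic₁ _<_ _<_ k →
                  (∀ t → 1 ≤ t → t ≤ T → k t * e t ≡ M) → ∑ T (λ t → φ (e t)) ≤ M
  ∑φ-cofactors≤ T M k e increasing factor = begin
      ∑ T (λ t → φ (e t))                      ≤⟨ ∑-mono T class≥φ ⟩
      ∑ T (λ t → ∑ M (gcdIs M (k t)))          ≡⟨ ∑-swap T M (λ t → gcdIs M (k t)) ⟩
      ∑ M (λ x → ∑ T (λ t → gcdIs M (k t) x))  ≤⟨ ∑-mono M (λ x _ _ → atMostOne T (gcd x M)) ⟩
      ∑ M (λ _ → 1)                            ≡⟨ trans (∑-const M 1) (*-identityʳ M) ⟩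
      M                                        ∎
    where
    open ≤-Reasoning
    -- k t ≥ 1 because k 0 < k t, so φ≤gcdClass applies.
    class≥φ : ∀ t → 1 ≤ t → t ≤ T → φ (e t) ≤ ∑ M (gcdIs M (k t))
    class≥φ t 1≤t t≤T with k t | factor t 1≤t t≤T | increasing 1≤t
    ... | suc k' | refl | _ = φ≤gcdClass k' (e t)
    -- Since k is injective, a given g equals k t for at most one t.
    atMostOne : ∀ n g → ∑ n (λ t → 𝟙 (g ≟ k t)) ≤ 1
    atMostOne zero    g = z≤n
    atMostOne (suc n) g with g ≟ k (suc n)
    ... | no _     = ≤-trans (≤-reflexive (+-identityʳ _)) (atMostOne n g)
    ... | yes refl = +-mono-≤ (≤-reflexive (∑-zero n _ (λ t _ t≤n →
                        𝟙-no (λ eq → <⇒≢ (increasing (s≤s t≤n)) (sym eq)) (k (suc n) ≟ k t)))) ≤-refl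

module SmallTotient where

  open FiniteSums
  open Totient using (φ-multiple; ∑φ-cofactors≤)
  open import Data.Nat
  open import Data.Nat.Properties
  open import Data.Nat.Solver using (module +-*-Solver)
  open +-*-Solver using (solve; _:*_; con; _:=_)
  open import Relation.Binary.Definitions using (Monotonic₁)
  open import Relation.Binary.PropositionalEquality

  dyadicBlock : ∀ F c P .{{_ : NonZero P}} (a : ℕ → ℕ) →
                (∀ x → 1 ≤ x → x ≤ P → F ≤ c * (2 * P) * a (P + x)) →
                F ≤ 2 * c * ∑ P (λ x → a (P + x))
  dyadicBlock F c P a bound = *-cancelˡ-≤ P (begin
      P * F                                 ≡⟨ ∑-const P F ⟨
      ∑ P (λ _ → F)                         ≤⟨ ∑-mono P bound ⟩
      ∑ P (λ x → c * (2 * P) * a (P + x))   ≡⟨ ∑-scale P (c * (2 * P)) (λ x → a (P + x)) ⟩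
      c * (2 * P) * S                       ≡⟨ solve 3 (λ c P S → c :* (con 2 :* P) :* S := P :* (con 2 :* c :* S)) refl c P S ⟩
      P * (2 * c * S)                       ∎)
    where
    open ≤-Reasoning
    S = ∑ P (λ x → a (P + x))

  -- Dyadic harmonic bound: if a_t ≥ F / (c t) for 1 ≤ t ≤ 2^J, then
  -- Σ_{t ≤ 2^J} a_t ≥ J F / (2c), one F / (2c) for each block 2^j < t ≤ 2^(j+1).
  dyadicHarmonic : ∀ F c (a : ℕ → ℕ) J →
                   (∀ t → 1 ≤ t → t ≤ 2 ^ J → F ≤ c * t * a t) → J * F ≤ 2 * c * ∑ (2 ^ J) a
  dyadicHarmonic F c a zero    bound = z≤n
  dyadicHarmonic F c a (suc J) bound = begin
      F + J * F                                     ≤⟨ +-mono-≤ (dyadicBlock F c P a upperBlock)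
                                                                  (dyadicHarmonic F c a J lowerBlock) ⟩
      2 * c * ∑ P (λ x → a (P + x)) + 2 * c * ∑ P a ≡⟨ +-comm (2 * c * ∑ P (λ x → a (P + x))) _ ⟩
      2 * c * ∑ P a + 2 * c * ∑ P (λ x → a (P + x)) ≡⟨ *-distribˡ-+ (2 * c) _ _ ⟨
      2 * c * (∑ P a + ∑ P (λ x → a (P + x)))       ≡⟨ cong (2 * c *_) (∑-split P P a) ⟨
      2 * c * ∑ (P + P) a                           ≡⟨ cong (λ n → 2 * c * ∑ (P + n) a) (+-identityʳ P) ⟨
      2 * c * ∑ (2 ^ suc J) a                       ∎
    where
    open ≤-Reasoning
    P = 2 ^ J
    instance
      P≢0 : NonZero P
      P≢0 = m^n≢0 2 J
    P+x≤2P : ∀ {x} → x ≤ P → P + x ≤ 2 * P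
    P+x≤2P x≤P = ≤-trans (+-monoʳ-≤ P x≤P) (≤-reflexive (cong (P +_) (sym (+-identityʳ P))))
    lowerBlock : ∀ t → 1 ≤ t → t ≤ P → F ≤ c * t * a t
    lowerBlock t 1≤t t≤P = bound t 1≤t (≤-trans t≤P (m≤m+n P (P + 0)))
    upperBlock : ∀ x → 1 ≤ x → x ≤ P → F ≤ c * (2 * P) * a (P + x)
    upperBlock x 1≤x x≤P = ≤-trans (bound (P + x) (≤-trans 1≤x (m≤n+m x P)) (P+x≤2P x≤P))
                                   (*-monoˡ-≤ (a (P + x)) (*-monoʳ-≤ c (P+x≤2P x≤P)))

  -- Indeed
  -- φ(M) ≤ k_t φ(e_t) ≤ c t φ(e_t), so J φ(M) ≤ 2 c Σ_t φ(e_t) ≤ 2 c M.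
  manyDivisors⇒smallTotient : ∀ J c M (k e : ℕ → ℕ) → Monotonic₁ _<_ _<_ k →
    (∀ t → 1 ≤ t → t ≤ 2 ^ J → k t * e t ≡ M) → (∀ t → 1 ≤ t → t ≤ 2 ^ J → k t ≤ c * t) →
    J * φ M ≤ 2 * c * M
  manyDivisors⇒smallTotient J c M k e increasing factor small = begin
      J * φ M                           ≤⟨ dyadicHarmonic (φ M) c (λ t → φ (e t)) J φM≤ ⟩
      2 * c * ∑ (2 ^ J) (λ t → φ (e t)) ≤⟨ *-monoʳ-≤ (2 * c) (∑φ-cofactors≤ (2 ^ J) M k e increasing factor) ⟩
      2 * c * M                         ∎
    where
    open ≤-Reasoning
    φM≤ : ∀ t → 1 ≤ t → t ≤ 2 ^ J → φ M ≤ c * t * φ (e t)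
    φM≤ t 1≤t t≤T = begin
      φ M             ≡⟨ cong φ (factor t 1≤t t≤T) ⟨
      φ (k t * e t)   ≤⟨ φ-multiple (k t) (e t) ⟩
      k t * φ (e t)   ≤⟨ *-monoˡ-≤ (φ (e t)) (small t 1≤t t≤T) ⟩
      c * t * φ (e t) ∎

module MultiplicativeOrder where

  open import Data.Nat
  open import Data.Nat.Properties
  open import Data.Nat.Divisibility
  open import Data.Nat.DivMod using (_%_; _/_; m≡m%n+[m/n]*n; m%n<n)
  open import Data.Nat.Coprimality using (Coprime; coprime-divisor)
  open import Data.Fin using (Fin; toℕ; fromℕ<)
  open import Data.Fin.Properties using (pigeonhole; toℕ-fromℕ<; toℕ<n)
  open import Data.Product using (∃₂)
  open import Relation.Binary.PropositionalEquality

  %≡⇒∣∸ : ∀ x y k .{{_ : NonZero k}} → x % k ≡ y % k → k ∣ y ∸ x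
  %≡⇒∣∸ x y k x≡y = divides (y / k ∸ x / k) (begin
      y ∸ x                                     ≡⟨ cong₂ _∸_ (m≡m%n+[m/n]*n y k) (m≡m%n+[m/n]*n x k) ⟩
      (y % k + y / k * k) ∸ (x % k + x / k * k) ≡⟨ cong (λ r → (y % k + y / k * k) ∸ (r + x / k * k)) x≡y ⟩
      (y % k + y / k * k) ∸ (y % k + x / k * k) ≡⟨ [m+n]∸[m+o]≡n∸o (y % k) _ _ ⟩
      y / k * k ∸ x / k * k                     ≡⟨ *-distribʳ-∸ k (y / k) (x / k) ⟨
      (y / k ∸ x / k) * k                       ∎)
    where open ≡-Reasoning

  coprime-^ : ∀ {k q} → Coprime k q → ∀ n → Coprime k (q ^ n)
  coprime-^ cop zero    (d∣k , d∣1) = ∣1⇒≡1 d∣1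
  coprime-^ cop (suc n) (d∣k , d∣q*qⁿ) =
    coprime-^ cop n (d∣k , coprime-divisor (λ (e∣d , e∣q) → cop (∣-trans e∣d d∣k , e∣q)) d∣q*qⁿ)

  -- x − 1 ∣ x^m − 1, written for x = y + 1.
  pred∣pred-^ : ∀ y m → y ∣ suc y ^ m ∸ 1
  pred∣pred-^ y zero    = divides 0 refl
  pred∣pred-^ y (suc m) = subst (y ∣_) (sym split) (∣m∣n⇒∣m+n (n∣m*n (suc y ^ m)) (pred∣pred-^ y m))
    where
    open ≡-Reasoning
    split : suc y ^ suc m ∸ 1 ≡ suc y ^ m * y + (suc y ^ m ∸ 1)
    split = begin
      (suc y ^ m + y * suc y ^ m) ∸ 1 ≡⟨ cong (_∸ 1) (+-comm (suc y ^ m) _) ⟩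
      (y * suc y ^ m + suc y ^ m) ∸ 1 ≡⟨ +-∸-assoc (y * suc y ^ m) (m^n>0 (suc y) m) ⟩
      y * suc y ^ m + (suc y ^ m ∸ 1) ≡⟨ cong (_+ (suc y ^ m ∸ 1)) (*-comm y _) ⟩
      suc y ^ m * y + (suc y ^ m ∸ 1) ∎

  ^∸1-mono-∣ : ∀ q {d i} → d ∣ i → q ^ d ∸ 1 ∣ q ^ i ∸ 1
  ^∸1-mono-∣ q {d} (divides r refl) = subst (λ n → q ^ d ∸ 1 ∣ q ^ n ∸ 1) (*-comm d r)
    (subst (λ x → q ^ d ∸ 1 ∣ x ∸ 1) (^-*-assoc q d r) (base (q ^ d) r))
    where
    base : ∀ x m → x ∸ 1 ∣ x ^ m ∸ 1
    base zero    zero    = divides 0 refl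
    base zero    (suc m) = divides 0 refl
    base (suc y) m       = pred∣pred-^ y m

  ^∸^ : ∀ q {a b} → a ≤ b → q ^ b ∸ q ^ a ≡ q ^ a * (q ^ (b ∸ a) ∸ 1)
  ^∸^ q {a} {b} a≤b = begin
      q ^ b ∸ q ^ a                   ≡⟨ cong (λ n → q ^ n ∸ q ^ a) (m+[n∸m]≡n a≤b) ⟨
      q ^ (a + (b ∸ a)) ∸ q ^ a       ≡⟨ cong (_∸ q ^ a) (^-distribˡ-+-* q a (b ∸ a)) ⟩
      q ^ a * q ^ (b ∸ a) ∸ q ^ a     ≡⟨ cong (q ^ a * q ^ (b ∸ a) ∸_) (*-identityʳ (q ^ a)) ⟨
      q ^ a * q ^ (b ∸ a) ∸ q ^ a * 1 ≡⟨ *-distribˡ-∸ (q ^ a) (q ^ (b ∸ a)) 1 ⟨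
      q ^ a * (q ^ (b ∸ a) ∸ 1)       ∎
    where open ≡-Reasoning

  -- Pigeonhole: two of the k + 1 powers q^0, …, q^k agree modulo k.
  powersCollide : ∀ q k .{{_ : NonZero k}} → ∃₂ λ a b → a < b × b ≤ k × q ^ a % k ≡ q ^ b % k
  powersCollide q k with pigeonhole (n<1+n k) residue
    where
    residue : Fin (suc k) → Fin k
    residue j = fromℕ< (m%n<n (q ^ toℕ j) k)
  ... | i , j , i<j , same = toℕ i , toℕ j , i<j , s≤s⁻¹ (toℕ<n j) ,
    trans (sym (toℕ-fromℕ< (m%n<n (q ^ toℕ i) k))) (trans (cong toℕ same) (toℕ-fromℕ< (m%n<n (q ^ toℕ j) k)))

  order : ∀ q k .{{_ : NonZero k}} → Coprime k q → ∃ λ d → 1 ≤ d × d ≤ k × k ∣ q ^ d ∸ 1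
  order q k cop with powersCollide q k
  ... | a , b , a<b , b≤k , same =
    b ∸ a , m<n⇒0<n∸m a<b , ≤-trans (m∸n≤m b a) b≤k ,
    coprime-divisor (coprime-^ cop a) (subst (k ∣_) (^∸^ q (<⇒≤ a<b)) (%≡⇒∣∸ (q ^ a) (q ^ b) k same))

module Averages where

  open import Data.Nat as ℕ using (zero)
  import Data.Nat.Properties as ℕ
  open import Data.Integer as ℤ using (+_)
  import Data.Integer.Properties as ℤ
  open import Data.Rational as ℚ using (ℚ; 0ℚ; mkℚ; toℚᵘ)
  import Data.Rational.Properties as ℚ
  open import Data.Rational.Unnormalised as ℚᵘ using (mkℚᵘ; *≤*; *<*; *≡*)
  import Data.Rational.Unnormalised.Properties as ℚᵘ
  open import Data.Nat.Solver using (module +-*-Solver)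
  open +-*-Solver using (solve; _:*_; _:+_; con; _:=_)
  open import Relation.Binary.PropositionalEquality

  mkℚᵘ-≤ : ∀ a b c d → a ℕ.* suc d ℕ.≤ c ℕ.* suc b → mkℚᵘ (+ a) b ℚᵘ.≤ mkℚᵘ (+ c) d
  mkℚᵘ-≤ a b c d h = *≤* (subst₂ ℤ._≤_ (ℤ.pos-* a (suc d)) (ℤ.pos-* c (suc b)) (ℤ.+≤+ h))

  mkℚᵘ-< : ∀ a b c d → a ℕ.* suc d ℕ.< c ℕ.* suc b → mkℚᵘ (+ a) b ℚᵘ.< mkℚᵘ (+ c) d
  mkℚᵘ-< a b c d h = *<* (subst₂ ℤ._<_ (ℤ.pos-* a (suc d)) (ℤ.pos-* c (suc b)) (ℤ.+<+ h))

  mkℚᵘ-≃ : ∀ a b c d → a ℕ.* suc d ≡ c ℕ.* suc b → mkℚᵘ (+ a) b ℚᵘ.≃ mkℚᵘ (+ c) d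
  mkℚᵘ-≃ a b c d h = *≡* (trans (sym (ℤ.pos-* a (suc d))) (trans (cong +_ h) (ℤ.pos-* c (suc b))))

  -- Sums and products of nonnegative fractions, in the normal form mkℚᵘ (+ numerator) (denominator − 1).
  mkℚᵘ-+ : ∀ a b c d → mkℚᵘ (+ a) b ℚᵘ.+ mkℚᵘ (+ c) d ℚᵘ.≃
                        mkℚᵘ (+ (a ℕ.* suc d ℕ.+ c ℕ.* suc b)) (d ℕ.+ b ℕ.* suc d)
  mkℚᵘ-+ a b c d = *≡* (cong (ℤ._* + suc (d ℕ.+ b ℕ.* suc d))
    (trans (cong₂ ℤ._+_ (sym (ℤ.pos-* a (suc d))) (sym (ℤ.pos-* c (suc b)))) (sym (ℤ.pos-+ (a ℕ.* suc d) (c ℕ.* suc b)))))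

  mkℚᵘ-* : ∀ a b c d → mkℚᵘ (+ a) b ℚᵘ.* mkℚᵘ (+ c) d ℚᵘ.≃ mkℚᵘ (+ (a ℕ.* c)) (d ℕ.+ b ℕ.* suc d)
  mkℚᵘ-* a b c d = *≡* (cong (ℤ._* + suc (d ℕ.+ b ℕ.* suc d)) (sym (ℤ.pos-* a c)))

  frac≃ : ∀ a b → toℚᵘ (frac a (suc b)) ℚᵘ.≃ mkℚᵘ (+ a) b
  frac≃ a b = ℚ.toℚᵘ-fromℚᵘ (mkℚᵘ (+ a) b)

  0≤frac : ∀ a b → 0ℚ ℚ.≤ frac a b
  0≤frac a zero    = ℚ.≤-refl
  0≤frac a (suc b) = ℚ.toℚᵘ-cancel-≤ (ℚᵘ.≤-respʳ-≃ (ℚᵘ.≃-sym (frac≃ a b)) (mkℚᵘ-≤ 0 0 a b ℕ.z≤n))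

  embed-suc : ∀ n → mkℚᵘ (+ n) 0 ℚᵘ.+ ℚᵘ.1ℚᵘ ℚᵘ.≃ mkℚᵘ (+ suc n) 0
  embed-suc n = ℚᵘ.≃-trans (mkℚᵘ-+ n 0 1 0)
    (mkℚᵘ-≃ _ _ (suc n) 0 (solve 1 (λ n → (n :* con 1 :+ con 1 :* con 1) :* con 1 := (con 1 :+ n) :* con 1) refl n))

  embed-inverse : ∀ n → mkℚᵘ (+ 1) n ℚᵘ.* mkℚᵘ (+ suc n) 0 ℚᵘ.≃ ℚᵘ.1ℚᵘ
  embed-inverse n = ℚᵘ.≃-trans (mkℚᵘ-* 1 n (suc n) 0)
    (mkℚᵘ-≃ _ _ 1 0 (solve 1 (λ n → con 1 :* (con 1 :+ n) :* con 1 := con 1 :* (con 1 :+ (con 0 :+ n :* con 1))) refl n))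

  ρ≤1/B : ∀ Q n B' → suc B' ℕ.* φ (Q ℕ.^ n ℕ.∸ 1) ℕ.≤ Q ℕ.^ n ℕ.∸ 1 → ρ Q n ℚ.≤ frac 1 (suc B')
  ρ≤1/B Q n B' = fraction≤ (Q ℕ.^ n)
    where
    fraction≤ : ∀ m → suc B' ℕ.* φ (m ℕ.∸ 1) ℕ.≤ m ℕ.∸ 1 → frac (φ (m ℕ.∸ 1)) m ℚ.≤ frac 1 (suc B')
    fraction≤ zero     _       =
      ℚ.toℚᵘ-cancel-≤ (ℚᵘ.≤-respʳ-≃ (ℚᵘ.≃-sym (frac≃ 1 B')) (mkℚᵘ-≤ 0 0 1 B' ℕ.z≤n))
    fraction≤ (suc m') Bφ≤m' = ℚ.toℚᵘ-cancel-≤ (begin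
        toℚᵘ (frac (φ m') (suc m')) ≃⟨ frac≃ (φ m') m' ⟩
        mkℚᵘ (+ φ m') m'             ≤⟨ mkℚᵘ-≤ (φ m') m' 1 B' cross ⟩
        mkℚᵘ (+ 1) B'                ≃⟨ frac≃ 1 B' ⟨
        toℚᵘ (frac 1 (suc B'))       ∎)
      where
      open ℚᵘ.≤-Reasoning
      cross : φ m' ℕ.* suc B' ℕ.≤ 1 ℕ.* suc m'
      cross = ℕ.≤-trans (ℕ.≤-reflexive (ℕ.*-comm (φ m') (suc B')))
                (ℕ.≤-trans Bφ≤m' (ℕ.≤-trans (ℕ.n≤1+n m') (ℕ.≤-reflexive (sym (ℕ.*-identityˡ (suc m'))))))

  ρavg≤ : ∀ Q (r : ℚ) → 0ℚ ℚ.≤ r → (∀ n → ρ Q n ℚ.≤ r) → ∀ x → ρavg Q x ℚ.≤ r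
  ρavg≤ Q r 0≤r ρ≤r zero    = ℚ.≤-trans (ℚ.≤-reflexive (ℚ.*-zeroˡ 0ℚ)) 0≤r
  ρavg≤ Q r 0≤r ρ≤r (suc x) = ℚ.toℚᵘ-cancel-≤ (begin
      toℚᵘ (frac 1 (suc x) ℚ.* ρsum Q (suc x))      ≃⟨ ℚ.toℚᵘ-homo-* (frac 1 (suc x)) (ρsum Q (suc x)) ⟩
      toℚᵘ (frac 1 (suc x)) ℚᵘ.* toℚᵘ (ρsum Q (suc x)) ≃⟨ ℚᵘ.*-congʳ {toℚᵘ (ρsum Q (suc x))} (frac≃ 1 x) ⟩
      mkℚᵘ (+ 1) x ℚᵘ.* toℚᵘ (ρsum Q (suc x))      ≤⟨ ℚᵘ.*-monoʳ-≤-nonNeg (mkℚᵘ (+ 1) x) (sum≤ (suc x)) ⟩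
      mkℚᵘ (+ 1) x ℚᵘ.* (mkℚᵘ (+ suc x) 0 ℚᵘ.* u) ≃⟨ ℚᵘ.*-assoc (mkℚᵘ (+ 1) x) (mkℚᵘ (+ suc x) 0) u ⟨
      (mkℚᵘ (+ 1) x ℚᵘ.* mkℚᵘ (+ suc x) 0) ℚᵘ.* u ≃⟨ ℚᵘ.*-congʳ {u} (embed-inverse x) ⟩
      ℚᵘ.1ℚᵘ ℚᵘ.* u                                ≃⟨ ℚᵘ.*-identityˡ u ⟩
      u                                            ∎)
    where
    open ℚᵘ.≤-Reasoning
    u = toℚᵘ r
    sum≤ : ∀ y → toℚᵘ (ρsum Q y) ℚᵘ.≤ mkℚᵘ (+ y) 0 ℚᵘ.* u
    sum≤ zero    = ℚᵘ.≤-reflexive (ℚᵘ.≃-sym (ℚᵘ.*-zeroˡ u))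
    sum≤ (suc y) = begin
      toℚᵘ (ρsum Q y ℚ.+ ρ Q (suc y))             ≃⟨ ℚ.toℚᵘ-homo-+ (ρsum Q y) (ρ Q (suc y)) ⟩
      toℚᵘ (ρsum Q y) ℚᵘ.+ toℚᵘ (ρ Q (suc y))      ≤⟨ ℚᵘ.+-mono-≤ (sum≤ y) (ℚ.toℚᵘ-mono-≤ (ρ≤r (suc y))) ⟩
      mkℚᵘ (+ y) 0 ℚᵘ.* u ℚᵘ.+ u                   ≃⟨ ℚᵘ.+-congʳ (mkℚᵘ (+ y) 0 ℚᵘ.* u) (ℚᵘ.*-identityˡ u) ⟨
      mkℚᵘ (+ y) 0 ℚᵘ.* u ℚᵘ.+ ℚᵘ.1ℚᵘ ℚᵘ.* u      ≃⟨ ℚᵘ.*-distribʳ-+ u (mkℚᵘ (+ y) 0) ℚᵘ.1ℚᵘ ⟨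
      (mkℚᵘ (+ y) 0 ℚᵘ.+ ℚᵘ.1ℚᵘ) ℚᵘ.* u           ≃⟨ ℚᵘ.*-congʳ {u} (embed-suc y) ⟩
      mkℚᵘ (+ suc y) 0 ℚᵘ.* u                      ∎

  -- Archimedean property: every positive rational exceeds some 1/B; for ε = (m + 1)/(d + 1)
  -- take B = d + 2.
  archimedean : ∀ (ε : ℚ) → 0ℚ ℚ.< ε → ∃ λ B' → frac 1 (suc B') ℚ.< ε
  archimedean (mkℚ (+ zero) d _)    (ℚ.*<* (ℤ.+<+ ()))
  archimedean (mkℚ ℤ.-[1+ m ] d _)  (ℚ.*<* ())
  archimedean (mkℚ (+ suc m) d _) _ = suc d , ℚ.toℚᵘ-cancel-< (ℚᵘ.≤-<-trans (ℚᵘ.≤-reflexive (frac≃ 1 (suc d)))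
    (mkℚᵘ-< 1 (suc d) (suc m) d (ℕ.≤-trans (ℕ.s≤s (ℕ.s≤s (ℕ.≤-reflexive (ℕ.+-identityʳ d)))) (ℕ.m≤m+n (suc (suc d)) _))))

module Construction where

  open SmallTotient using (manyDivisors⇒smallTotient)
  open MultiplicativeOrder using (order; ^∸1-mono-∣)
  open import Data.Nat
  open import Data.Nat.Properties
  open import Data.Nat.Divisibility
  open import Data.Nat.DivMod using (_/_; m*[n/m]≡n)
  open import Data.Nat.Coprimality using (Coprime)
  open import Data.Nat.Primality using (prime⇒nonZero)
  open import Relation.Binary.PropositionalEquality using (_≡_; refl; sym; subst)

  ∣! : ∀ {d P} → 1 ≤ d → d ≤ P → d ∣ P !
  ∣! {suc d'} _ d≤P = ∣-trans (m∣m*n (d' !)) (m≤n⇒m!∣n! d≤P)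

  q*t+1-coprime : ∀ q t → Coprime (suc (q * t)) q
  q*t+1-coprime q t {d} (d∣qt+1 , d∣q) =
    ∣1⇒≡1 (∣m+n∣m⇒∣n (subst (d ∣_) (+-comm 1 (q * t)) d∣qt+1) (∣-trans d∣q (m∣m*n t)))

  -- If P! ∣ i, then every k ≤ P coprime to q divides (q^i)^n − 1: the order d ≤ k of q
  -- modulo k divides P!, hence i n.
  ∣^∸1 : ∀ q P i n k .{{_ : NonZero k}} → Coprime k q → k ≤ P → P ! ∣ i → k ∣ (q ^ i) ^ n ∸ 1
  ∣^∸1 q P i n k cop k≤P P!∣i with order q k cop
  ... | d , 1≤d , d≤k , k∣qᵈ∸1 = ∣-trans k∣qᵈ∸1 (subst (λ m → q ^ d ∸ 1 ∣ m ∸ 1) (sym (^-*-assoc q i n))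
          (^∸1-mono-∣ q (∣-trans (∣! 1≤d (≤-trans d≤k k≤P)) (∣-trans P!∣i (m∣m*n n)))))

  Bφ≤ : ∀ q B M → 1 ≤ q → (∀ t → 1 ≤ t → t ≤ 2 ^ (2 * suc q * B) → suc (q * t) ∣ M) → B * φ M ≤ M
  Bφ≤ q B M 1≤q divisors = *-cancelˡ-≤ (2 * suc q) (begin
      2 * suc q * (B * φ M) ≡⟨ *-assoc (2 * suc q) B (φ M) ⟨
      J * φ M               ≤⟨ manyDivisors⇒smallTotient J (suc q) M k (λ t → M / k t) increasing factor small ⟩
      2 * suc q * M         ∎)
    where
    open ≤-Reasoning
    J = 2 * suc q * B
    k : ℕ → ℕ
    k t = suc (q * t)
    increasing : ∀ {s t} → s < t → k s < k t
    increasing s<t = s≤s (*-monoʳ-< q {{>-nonZero 1≤q}} s<t)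
    factor : ∀ t → 1 ≤ t → t ≤ 2 ^ J → k t * (M / k t) ≡ M
    factor t 1≤t t≤T = m*[n/m]≡n (divisors t 1≤t t≤T)
    small : ∀ t → 1 ≤ t → t ≤ 2 ^ J → k t ≤ suc q * t
    small t 1≤t _ = +-monoˡ-≤ (q * t) 1≤t

  primePower≥1 : ∀ {q} → IsPrimePower q → 1 ≤ q
  primePower≥1 (p , k , p-prime , _ , refl) = m^n>0 p {{prime⇒nonZero p-prime}} k

  exponent : ℕ → ℕ → ℕ → ℕ
  exponent q B N = suc N * suc (q * 2 ^ (2 * suc q * B)) !

  N≤exponent : ∀ q B N → N ≤ exponent q B N
  N≤exponent q B N = ≤-trans (m≤m*n N (P !) {{P !≢0}}) (m≤n+m (N * P !) (P !))
    where P = suc (q * 2 ^ (2 * suc q * B))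

  Bφ≤-at-exponent : ∀ q B N n → 1 ≤ q →
    let M = (q ^ exponent q B N) ^ n ∸ 1 in B * φ M ≤ M
  Bφ≤-at-exponent q B N n 1≤q = Bφ≤ q B _ 1≤q (λ t _ t≤T →
    ∣^∸1 q P (exponent q B N) n (suc (q * t)) (q*t+1-coprime q t) (s≤s (*-monoʳ-≤ q t≤T)) (n∣m*n (suc N)))
    where P = suc (q * 2 ^ (2 * suc q * B))

open import Data.Rational using (ℚ; 0ℚ; _<_)
import Data.Rational as ℚ
import Data.Rational.Properties as ℚ
open Averages using (ρ≤1/B; ρavg≤; archimedean; 0≤frac)
open Construction using (primePower≥1; exponent; N≤exponent; Bφ≤-at-exponent)

proposition4p4 : (q : ℕ) → IsPrimePower q →
    (ε : ℚ) → 0ℚ < ε → (N : ℕ) →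
    ∃ λ i → N ≤ i × ∃ λ X₀ → (x : ℕ) → X₀ ≤ x → ρavg (q ^ i) x < ε
proposition4p4 q q-primePower ε 0<ε N with archimedean ε 0<ε
... | B' , 1/B<ε = i , N≤exponent q B N , 0 ,
      λ x _ → ℚ.≤-<-trans (ρavg≤ (q ^ i) (frac 1 B) (0≤frac 1 B) ρ≤ x) 1/B<ε
  where
  B = suc B'
  i = exponent q B N
  ρ≤ : ∀ n → ρ (q ^ i) n ℚ.≤ frac 1 B
  ρ≤ n = ρ≤1/B (q ^ i) n B' (Bφ≤-at-exponent q B N n (primePower≥1 q-primePower))
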